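{- Let $Y=\{z_k:k\in\mathbb{Z}\}$, let $\mathcal{H}=\mathbb{Q}\langle Y\rangle$ be the $\mathbb{Q}$-vector space spanned by words in $Y$ (including the empty word $\mathbf{1}$), with deconcatenation coproduct $\Delta(w)=\sum_{uv=w}u\otimes v$ and reduced coproduct $\widetilde\Delta(w)=\Delta(w)-\mathbf{1}\otimes w-w\otimes\mathbf{1}$ for nonempty words $w$. Call a word $z_{k_1}\cdots z_{k_n}$ non-singular if $k_1\neq1$, $k_1+k_2\notin\{2,1,0,-2,-4,-6,\ldots\}$, and $k_1+\cdots+k_j\notin\mathbb{Z}_{\le j}$ for all $3\le j\le n$ (conditions involving indices exceeding $n$ being void), and let $N\subseteq\mathcal{H}$ be the linear span of non-singular words. Then $\widetilde\Delta(N)\subseteq N\otimes\mathcal{H}$ (i.e. $N$ is a left coideal for $\widetilde\Delta$). Moreover, for every non-singular word $w$ of length $n$ and every composition $I$ of $n$, the contracted word $I[w]$ lies in $N$.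
   Context: A composition of $n$ is a sequence $I=(i_1,\ldots,i_m)$ of positive integers with $i_1+\cdots+i_m=n$. For $w=z_{k_1}\cdots z_{k_n}$, the contracted word is $I[w]=z_{k_1+\cdots+k_{i_1}}z_{k_{i_1+1}+\cdots+k_{i_1+i_2}}\cdots z_{k_{n-i_m+1}+\cdots+k_n}$. -}

module Defs where

open import Data.Nat as ℕ using (ℕ; zero; suc)
open import Data.Integer as ℤ using (ℤ; +_)
open import Data.Integer.Divisibility using () renaming (_∣_ to _∣ℤ_)
open import Data.Rational as ℚ using (ℚ; 0ℚ; 1ℚ)
open import Data.List using (List; []; _∷_; map; concatMap; take; drop; foldr; _++_)
open import Data.List.Relation.Unary.All using (All)
open import Data.List.Properties using (≡-dec)
open import Data.Product using (_×_; _,_)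
open import Data.Unit using (⊤)
open import Relation.Binary.PropositionalEquality using (_≡_; _≢_)
open import Relation.Nullary using (¬_; yes; no)

-- A word z_{k_1} ⋯ z_{k_n} over Y = {z_k : k ∈ ℤ} is the list [k_1, …, k_n].
Word : Set
Word = List ℤ

_≟W_ : (u v : Word) → Relation.Nullary.Dec (u ≡ v)
_≟W_ = ≡-dec ℤ._≟_

-- Condition on the j-th partial sum S_j = k_1 + ⋯ + k_j.
Cond : ℕ → ℤ → Set
Cond 0 s = ⊤
Cond 1 s = s ≢ + 1
Cond 2 s = (s ≢ + 2) × (s ≢ + 1) × ¬ ((s ℤ.≤ + 0) × ((+ 2) ∣ℤ s))
Cond (suc (suc (suc j))) s = + (suc (suc (suc j))) ℤ.< s

-- nsAux j s ks : the conditions for indices j+1, j+2, … where s = S_j.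
nsAux : ℕ → ℤ → List ℤ → Set
nsAux j s [] = ⊤
nsAux j s (k ∷ ks) = Cond (suc j) (s ℤ.+ k) × nsAux (suc j) (s ℤ.+ k) ks

NonSingular : Word → Set
NonSingular w = nsAux 0 (+ 0) w

-- Elements of ℋ = ℚ⟨Y⟩ as formal finite linear combinations of words.
ℋ : Set
ℋ = List (ℚ × Word)

coeff : ℋ → Word → ℚ
coeff [] w = 0ℚ
coeff ((q , u) ∷ x) w with u ≟W w
... | yes _ = q ℚ.+ coeff x w
... | no _  = coeff x w

word : Word → ℋ
word w = (1ℚ , w) ∷ []

-- Elements of ℋ ⊗ ℋ as formal finite linear combinations of u ⊗ v
-- (the words u ⊗ v form a basis of ℋ ⊗ ℋ).
ℋ⊗ℋ : Set
ℋ⊗ℋ = List (ℚ × Word × Word)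

coeff₂ : ℋ⊗ℋ → Word → Word → ℚ
coeff₂ [] u v = 0ℚ
coeff₂ ((q , u' , v') ∷ t) u v with u' ≟W u | v' ≟W v
... | yes _ | yes _ = q ℚ.+ coeff₂ t u v
... | _     | _     = coeff₂ t u v

-- N = span of non-singular words: x ∈ N iff its support consists of non-singular words.
_∈N : ℋ → Set
x ∈N = ∀ w → coeff x w ≢ 0ℚ → NonSingular w

-- N ⊗ ℋ = span of u ⊗ v with u non-singular.
_∈N⊗ℋ : ℋ⊗ℋ → Set
t ∈N⊗ℋ = ∀ u v → coeff₂ t u v ≢ 0ℚ → NonSingular u

splitsNE : Word → List (Word × Word)
splitsNE [] = []
splitsNE (a ∷ []) = []
splitsNE (a ∷ b ∷ w) = ((a ∷ []) , (b ∷ w)) ∷ map (λ { (u , v) → (a ∷ u , v) }) (splitsNE (b ∷ w))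

Δ̃w : Word → ℋ⊗ℋ
Δ̃w w = map (λ { (u , v) → (1ℚ , u , v) }) (splitsNE w)

Δ̃ : ℋ → ℋ⊗ℋ
Δ̃ x = concatMap (λ { (q , w) → map (λ { (c , u , v) → (q ℚ.* c , u , v) }) (Δ̃w w) }) x

sumℕ : List ℕ → ℕ
sumℕ = foldr ℕ._+_ 0

IsComposition : ℕ → List ℕ → Set
IsComposition n I = All (λ i → 0 ℕ.< i) I × (sumℕ I ≡ n)

sumℤ : List ℤ → ℤ
sumℤ = foldr ℤ._+_ (+ 0)

contract : List ℕ → Word → Word
contract [] w = []
contract (i ∷ I) w = sumℤ (take i w) ∷ contract I (drop i w)

{-# OPTIONS --safe #-}
module Submission where

-- Coideal: the conditions defining non-singularity of z_{k₁}⋯z_{kₙ} only involve the partial sums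
-- S_j with j ≤ n, so they are inherited by every prefix, and Δ̃ only produces tensors u ⊗ v
-- whose concatenation u v occurs in the argument.
-- Contraction: the j-th partial sum of I[w] is the (i₁+⋯+i_j)-th partial sum of w, and the
-- condition on S_j weakens as j decreases (S_j > j forces S_j > j' for j' ≤ j and the
-- condition on S₂), so it survives the passage from the index i₁+⋯+i_j ≥ j to j.

open import Defs
open import Data.List using (List; []; _∷_; length; map; take; drop; _++_)
open import Data.List.Properties using (length-drop)
open import Data.List.Relation.Unary.All as All using (All; []; _∷_)
open import Data.List.Relation.Unary.Any as Any using (Any; here; there)
import Data.List.Relation.Unary.Any.Properties as Any
open import Data.Nat as ℕ using (ℕ; zero; suc; z≤n; s≤s)
import Data.Nat.Properties as ℕ
open import Data.Integer as ℤ using (+_)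
import Data.Integer.Properties as ℤ
open import Data.Rational as ℚ using (ℚ; 0ℚ)
import Data.Rational.Properties as ℚ
open import Data.Product using (_×_; _,_; proj₁; proj₂)
open import Data.Unit using (tt)
open import Data.Empty using (⊥-elim)
open import Relation.Nullary using (yes; no)
open import Relation.Binary.PropositionalEquality

+<⇒+< : ∀ {m n s} → m ℕ.≤ n → + n ℤ.< s → + m ℤ.< s
+<⇒+< m≤n n<s = ℤ.≤-<-trans (ℤ.+≤+ m≤n) n<s

+<⇒≢ : ∀ {m n s} → m ℕ.< n → + n ℤ.< s → s ≢ + m
+<⇒≢ m<n n<s refl = ℤ.<-irrefl refl (+<⇒+< (ℕ.<⇒≤ m<n) n<s)

Cond-antitone : ∀ {i j s} → i ℕ.≤ j → Cond j s → Cond i s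
Cond-antitone {zero} _ _ = tt
Cond-antitone {1} {1} _ c = c
Cond-antitone {1} {2} _ c = proj₁ (proj₂ c)
Cond-antitone {1} {suc (suc (suc _))} _ c = +<⇒≢ (s≤s (s≤s z≤n)) c
Cond-antitone {2} {2} _ c = c
Cond-antitone {2} {suc (suc (suc _))} _ c =
  +<⇒≢ (s≤s (s≤s (s≤s z≤n))) c , +<⇒≢ (s≤s (s≤s z≤n)) c ,
  λ (s≤0 , _) → ℤ.<⇒≱ (+<⇒+< z≤n c) s≤0
Cond-antitone {suc (suc (suc _))} {suc (suc (suc _))} i≤j c = +<⇒+< i≤j c
Cond-antitone {suc (suc _)} {1} (s≤s ()) _
Cond-antitone {suc (suc (suc _))} {2} (s≤s (s≤s ())) _

nsAux-antitone : ∀ {i j s} w → i ℕ.≤ j → nsAux j s w → nsAux i s w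
nsAux-antitone []      _   _       = tt
nsAux-antitone (k ∷ w) i≤j (c , r) =
  Cond-antitone (s≤s i≤j) c , nsAux-antitone w (s≤s i≤j) r

nsAux-++⁻ˡ : ∀ {j s} u v → nsAux j s (u ++ v) → nsAux j s u
nsAux-++⁻ˡ []      v _       = tt
nsAux-++⁻ˡ (k ∷ u) v (c , r) = c , nsAux-++⁻ˡ u v r

nsAux-take-drop : ∀ {j s} i w → suc i ℕ.≤ length w → nsAux j s w →
  let s′ = s ℤ.+ sumℤ (take (suc i) w) in
  Cond (suc i ℕ.+ j) s′ × nsAux (suc i ℕ.+ j) s′ (drop (suc i) w)
nsAux-take-drop {s = s} zero (k ∷ w) _ (c , r) rewrite ℤ.+-identityʳ k = c , r
nsAux-take-drop {j} {s} (suc i) (k ∷ w) (s≤s i<∣w∣) (_ , r) =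
  subst₂ (λ n t → Cond n t × nsAux n t (drop (suc i) w))
    (ℕ.+-suc (suc i) j) (ℤ.+-assoc s k (sumℤ (take (suc i) w)))
    (nsAux-take-drop i w i<∣w∣ r)

nsAux-contract : ∀ {j s} I w → All (0 ℕ.<_) I → sumℕ I ≡ length w →
  nsAux j s w → nsAux j s (contract I w)
nsAux-contract [] w _ _ _ = tt
nsAux-contract {j} (suc i ∷ I) w (_ ∷ I>0) ΣI≡∣w∣ ns =
  Cond-antitone j<i+j c ,
  nsAux-antitone (contract I rest) j<i+j
    (nsAux-contract I rest I>0 ΣI≡∣rest∣ r)
  where
  rest = drop (suc i) w
  j<i+j : suc j ℕ.≤ suc i ℕ.+ j
  j<i+j = s≤s (ℕ.m≤n+m j i)
  cr = nsAux-take-drop i w (subst (suc i ℕ.≤_) ΣI≡∣w∣ (ℕ.m≤m+n (suc i) (sumℕ I))) ns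
  c = proj₁ cr
  r = proj₂ cr
  ΣI≡∣rest∣ : sumℕ I ≡ length rest
  ΣI≡∣rest∣ = begin
    sumℕ I                       ≡⟨ ℕ.m+n∸m≡n (suc i) (sumℕ I) ⟨
    suc i ℕ.+ sumℕ I ℕ.∸ suc i   ≡⟨ cong (ℕ._∸ suc i) ΣI≡∣w∣ ⟩
    length w ℕ.∸ suc i           ≡⟨ length-drop (suc i) w ⟨
    length rest                  ∎
    where open ≡-Reasoning

word∈N : ∀ w → NonSingular w → word w ∈N
word∈N w ns w′ nz with w ≟W w′
... | yes refl = ns
... | no _     = ⊥-elim (nz refl)

coeff₂-++ : ∀ s t u v → coeff₂ (s ++ t) u v ≡ coeff₂ s u v ℚ.+ coeff₂ t u v
coeff₂-++ []                  t u v = sym (ℚ.+-identityˡ _)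
coeff₂-++ ((q , a , b) ∷ s) t u v with a ≟W u | b ≟W v
... | yes _ | yes _ = trans (cong (q ℚ.+_) (coeff₂-++ s t u v)) (sym (ℚ.+-assoc q _ _))
... | yes _ | no _  = coeff₂-++ s t u v
... | no _  | _     = coeff₂-++ s t u v

-- f is left abstract since Δ̃ scales by an anonymous pattern lambda of Defs.
coeff₂-map-scale : ∀ q (f : ℚ × Word × Word → ℚ × Word × Word) →
  (∀ c a b → f (c , a , b) ≡ (q ℚ.* c , a , b)) →
  ∀ t u v → coeff₂ (map f t) u v ≡ q ℚ.* coeff₂ t u v
coeff₂-map-scale q f f≗ [] u v = sym (ℚ.*-zeroʳ q)
coeff₂-map-scale q f f≗ ((c , a , b) ∷ t) u v rewrite f≗ c a b with a ≟W u | b ≟W v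
... | yes _ | yes _ =
  trans (cong (q ℚ.* c ℚ.+_) (coeff₂-map-scale q f f≗ t u v)) (sym (ℚ.*-distribˡ-+ q c _))
... | yes _ | no _  = coeff₂-map-scale q f f≗ t u v
... | no _  | _     = coeff₂-map-scale q f f≗ t u v

coeff₂≢0⇒Any : ∀ t u v → coeff₂ t u v ≢ 0ℚ → Any (λ e → proj₂ e ≡ (u , v)) t
coeff₂≢0⇒Any [] u v nz = ⊥-elim (nz refl)
coeff₂≢0⇒Any ((q , a , b) ∷ t) u v nz with a ≟W u | b ≟W v
... | yes refl | yes refl = here refl
... | yes _    | no _     = there (coeff₂≢0⇒Any t u v nz)
... | no _     | _        = there (coeff₂≢0⇒Any t u v nz)

splitsNE-sound : ∀ w → All (λ (u , v) → u ++ v ≡ w) (splitsNE w)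
splitsNE-sound []          = []
splitsNE-sound (a ∷ [])    = []
splitsNE-sound (a ∷ b ∷ w) =
  refl ∷ All.map⁺ (All.map (cong (a ∷_)) (splitsNE-sound (b ∷ w)))
  where import Data.List.Relation.Unary.All.Properties as All

Δ̃w-support : ∀ w u v → coeff₂ (Δ̃w w) u v ≢ 0ℚ → u ++ v ≡ w
Δ̃w-support w u v nz =
  All.lookupWith concat≡ (splitsNE-sound w) (Any.map⁻ (coeff₂≢0⇒Any (Δ̃w w) u v nz))
  where
  concat≡ : ∀ {(a , b) : Word × Word} → a ++ b ≡ w → (a , b) ≡ (u , v) → u ++ v ≡ w
  concat≡ e refl = e

Δ̃w-offDiagonal : ∀ w u v → w ≢ u ++ v → coeff₂ (Δ̃w w) u v ≡ 0ℚ
Δ̃w-offDiagonal w u v w≢uv with coeff₂ (Δ̃w w) u v ℚ.≟ 0ℚ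
... | yes z  = z
... | no nz = ⊥-elim (w≢uv (sym (Δ̃w-support w u v nz)))

coeff₂-Δ̃ : ∀ x u v → coeff₂ (Δ̃ x) u v ≡ coeff x (u ++ v) ℚ.* coeff₂ (Δ̃w (u ++ v)) u v
coeff₂-Δ̃ [] u v = sym (ℚ.*-zeroˡ (coeff₂ (Δ̃w (u ++ v)) u v))
coeff₂-Δ̃ ((q , w) ∷ x) u v = begin
  coeff₂ (map _ (Δ̃w w) ++ Δ̃ x) u v
    ≡⟨ coeff₂-++ (map _ (Δ̃w w)) (Δ̃ x) u v ⟩
  coeff₂ (map _ (Δ̃w w)) u v ℚ.+ coeff₂ (Δ̃ x) u v
    ≡⟨ cong₂ ℚ._+_ (coeff₂-map-scale q _ (λ _ _ _ → refl) (Δ̃w w) u v) (coeff₂-Δ̃ x u v) ⟩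
  q ℚ.* coeff₂ (Δ̃w w) u v ℚ.+ coeff x (u ++ v) ℚ.* δ
    ≡⟨ collect ⟩
  coeff ((q , w) ∷ x) (u ++ v) ℚ.* δ
    ∎
  where
  open ≡-Reasoning
  δ = coeff₂ (Δ̃w (u ++ v)) u v
  collect : q ℚ.* coeff₂ (Δ̃w w) u v ℚ.+ coeff x (u ++ v) ℚ.* δ
          ≡ coeff ((q , w) ∷ x) (u ++ v) ℚ.* δ
  collect with w ≟W (u ++ v)
  ... | yes refl = sym (ℚ.*-distribʳ-+ δ q (coeff x w))
  ... | no w≢uv  rewrite Δ̃w-offDiagonal w u v w≢uv | ℚ.*-zeroʳ q = ℚ.+-identityˡ _

Δ̃-support : ∀ x u v → coeff₂ (Δ̃ x) u v ≢ 0ℚ → coeff x (u ++ v) ≢ 0ℚ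
Δ̃-support x u v nz c≡0 =
  nz (trans (coeff₂-Δ̃ x u v) (trans (cong (ℚ._* δ) c≡0) (ℚ.*-zeroˡ δ)))
  where δ = coeff₂ (Δ̃w (u ++ v)) u v

lemma4p3 : ((x : ℋ) → x ∈N → Δ̃ x ∈N⊗ℋ)
    × ((w : Word) → NonSingular w → (I : List ℕ) → IsComposition (length w) I
    → word (contract I w) ∈N)
lemma4p3 = N-leftCoideal , contract∈N
  where
  N-leftCoideal : (x : ℋ) → x ∈N → Δ̃ x ∈N⊗ℋ
  N-leftCoideal x x∈N u v nz = nsAux-++⁻ˡ u v (x∈N (u ++ v) (Δ̃-support x u v nz))

  contract∈N : (w : Word) → NonSingular w → (I : List ℕ) → IsComposition (length w) I
    → word (contract I w) ∈N
  contract∈N w ns I (I>0 , ΣI≡n) = word∈N (contract I w) (nsAux-contract I w I>0 ΣI≡n ns)
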